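{- Let $\mathbf A$ be a residuated ortholattice, with ${\sim}x:=x\backslash0$, $\overline x:={\sim}{\sim}x$, and $x*y:=x\wedge({\sim}x\vee y)$. Then for all $x,y\in A$: (1) $\overline{\overline x}=\overline x$ and $\overline{\neg x}={\sim}\overline x={\sim}x$; (2) $\overline{x\vee y}=\overline x\vee\overline y$ and $\overline{x\wedge y}=\overline x\wedge\overline y$; (3) $\overline{x\cdot y}=\overline x*\overline y$.
   Context: A residuated ortholattice is an algebra $(A,\wedge,\vee,\neg,\backslash,0,1)$ where $(A,\wedge,\vee,0,1)$ is a bounded lattice, $\neg$ is an order-reversing involution, and $x\cdot y\le z\iff y\le x\backslash z$ for all $x,y,z$, where $x\cdot y:=x\wedge(\neg x\vee y)$ is the Sasaki product. -}

module Defs where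

open import Level using (Level; suc; _⊔_)
open import Data.Product using (_×_)
open import Relation.Binary.PropositionalEquality using (_≡_)
open import Algebra.Core using (Op₁; Op₂)
open import Algebra.Lattice.Structures using (IsLattice)

record ResiduatedOrtholattice (a : Level) : Set (suc a) where
  infixr 7 _∧_
  infixr 6 _∨_
  infix  4 _≤_
  field
    Carrier : Set a
    _∧_ _∨_ : Op₂ Carrier
    ¬       : Op₁ Carrier
    _\\_    : Op₂ Carrier
    𝟘 𝟙     : Carrier
    isLattice : IsLattice _≡_ _∨_ _∧_
    𝟘-least   : ∀ x → 𝟘 ∧ x ≡ 𝟘
    𝟙-greatest : ∀ x → x ∧ 𝟙 ≡ x

  _≤_ : Carrier → Carrier → Set a
  x ≤ y = x ∧ y ≡ x

  field
    ¬-involutive : ∀ x → ¬ (¬ x) ≡ x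
    ¬-antitone   : ∀ {x y} → x ≤ y → ¬ y ≤ ¬ x

  _·_ : Op₂ Carrier
  x · y = x ∧ (¬ x ∨ y)

  field
    residuation-to   : ∀ {x y z} → x · y ≤ z → y ≤ x \\ z
    residuation-from : ∀ {x y z} → y ≤ x \\ z → x · y ≤ z

  ∼ : Op₁ Carrier
  ∼ x = x \\ 𝟘

  ‾ : Op₁ Carrier
  ‾ x = ∼ (∼ x)

  _*_ : Op₂ Carrier
  x * y = x ∧ (∼ x ∨ y)

{-# OPTIONS --safe #-}

-- The operation ∼ x = x \ 𝟘 is an antitone Galois connection with itself, so
-- ‾ is a closure operator and ∼ ‾ = ∼. Orthocomplementation gives ¬ x ≤ ∼ x, and
-- since every z satisfies z ≤ z · ¬ x ∨ z · x, only 𝟘 lies below both ∼ x and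
-- ∼ ¬ x; this forces ‾ x = ∼ ¬ x, so ‾ preserves meets by De Morgan for ¬.
-- For joins one needs ∼ (x ∧ y) ≤ ∼ x ∨ ∼ y: split d = ∼ (x ∧ y) along
-- 𝟙 ≤ ¬ (x ∧ y) ∨ (x ∧ y) ≤ (∼ x ∨ ∼ y) ∨ (x ∧ y) with the Sasaki product, and
-- bound d · ∼ x by ‾ ∼ x = ∼ x using u · v ≤ ‾ v for v ≤ u.
-- Part (3) is parts (1) and (2) applied to x ∧ (¬ x ∨ y).

module Submission where

open import Defs
open import Level using (Level)
open import Data.Product using (_×_; _,_)
open import Relation.Binary.PropositionalEquality
  using (_≡_; sym; trans; cong; cong₂; isEquivalence)
import Algebra.Lattice.Bundles as Alg
import Algebra.Lattice.Properties.Lattice as AlgProperties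
import Relation.Binary.Lattice as Ord
import Relation.Binary.Lattice.Properties.MeetSemilattice as MeetProperties
import Relation.Binary.Lattice.Properties.JoinSemilattice as JoinProperties
import Relation.Binary.Reasoning.PartialOrder as ≤-Reasoning

module ResiduatedOrtholatticeProperties {a : Level} (A : ResiduatedOrtholattice a) where
  open ResiduatedOrtholattice A

  private
    algLattice : Alg.Lattice a a
    algLattice = record { _≈_ = _≡_ ; _∨_ = _∨_ ; _∧_ = _∧_ ; isLattice = isLattice }

    -- The library orders a lattice by x ≡ x ∧ y; the record uses the mirror image.
    module Natural = Ord.IsLattice (AlgProperties.∨-∧-isOrderTheoreticLattice algLattice)

  orderLattice : Ord.Lattice a a a
  orderLattice = record
    { _≈_ = _≡_
    ; _≤_ = _≤_
    ; _∨_ = _∨_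
    ; _∧_ = _∧_
    ; isLattice = record
      { isPartialOrder = record
        { isPreorder = record
          { isEquivalence = isEquivalence
          ; reflexive = λ x≡y → sym (Natural.reflexive x≡y)
          ; trans = λ x≤y y≤z → sym (Natural.trans (sym x≤y) (sym y≤z))
          }
        ; antisym = λ x≤y y≤x → Natural.antisym (sym x≤y) (sym y≤x)
        }
      ; supremum = λ x y →
          let x≤x∨y , y≤x∨y , least = Natural.supremum x y
          in sym x≤x∨y , sym y≤x∨y , λ z x≤z y≤z → sym (least z (sym x≤z) (sym y≤z))
      ; infimum = λ x y →
          let x∧y≤x , x∧y≤y , greatest = Natural.infimum x y
          in sym x∧y≤x , sym x∧y≤y , λ z z≤x z≤y → sym (greatest z (sym z≤x) (sym z≤y))
      }
    }

  open Ord.Lattice orderLattice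
    using (poset; x∧y≤x; x∧y≤y; ∧-greatest; x≤x∨y; y≤x∨y; ∨-least)
    renaming (refl to ≤-refl; reflexive to ≤-reflexive; trans to ≤-trans; antisym to ≤-antisym)
  open MeetProperties (Ord.Lattice.meetSemilattice orderLattice) using (∧-monotonic)
  open JoinProperties (Ord.Lattice.joinSemilattice orderLattice) using (∨-monotonic; x≤y⇒x∨y≈y)
  open ≤-Reasoning poset

  ¬x≤y⇒¬y≤x : ∀ {x y} → ¬ x ≤ y → ¬ y ≤ x
  ¬x≤y⇒¬y≤x {x} {y} ¬x≤y = begin
    ¬ y      ≤⟨ ¬-antitone ¬x≤y ⟩
    ¬ (¬ x)  ≡⟨ ¬-involutive x ⟩
    x        ∎

  x≤¬y⇒y≤¬x : ∀ {x y} → x ≤ ¬ y → y ≤ ¬ x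
  x≤¬y⇒y≤¬x {x} {y} x≤¬y = begin
    y        ≡⟨ ¬-involutive y ⟨
    ¬ (¬ y)  ≤⟨ ¬-antitone x≤¬y ⟩
    ¬ x      ∎

  deMorgan₁ : ∀ x y → ¬ (x ∧ y) ≡ ¬ x ∨ ¬ y
  deMorgan₁ x y = ≤-antisym
    (¬x≤y⇒¬y≤x (∧-greatest (¬x≤y⇒¬y≤x (x≤x∨y (¬ x) (¬ y)))
                            (¬x≤y⇒¬y≤x (y≤x∨y (¬ x) (¬ y)))))
    (∨-least (¬-antitone (x∧y≤x x y)) (¬-antitone (x∧y≤y x y)))

  ·-monoʳ-≤ : ∀ {x y z} → y ≤ z → x · y ≤ x · z
  ·-monoʳ-≤ y≤z = ∧-monotonic ≤-refl (∨-monotonic ≤-refl y≤z)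

  x·y≤x : ∀ x y → x · y ≤ x
  x·y≤x x y = x∧y≤x x (¬ x ∨ y)

  ·-distribˡ-∨-≤ : ∀ x y z → x · (y ∨ z) ≤ x · y ∨ x · z
  ·-distribˡ-∨-≤ x y z = residuation-from
    (∨-least (residuation-to (x≤x∨y (x · y) (x · z))) (residuation-to (y≤x∨y (x · y) (x · z))))

  ¬x≤y⇒x·y≡x∧y : ∀ {x y} → ¬ x ≤ y → x · y ≡ x ∧ y
  ¬x≤y⇒x·y≡x∧y {x} ¬x≤y = cong (x ∧_) (x≤y⇒x∨y≈y ¬x≤y)

  x≤y⇒x≤x·y : ∀ {x y} → x ≤ y → x ≤ x · y
  x≤y⇒x≤x·y {x} x≤y = ∧-greatest ≤-refl (≤-trans x≤y (y≤x∨y (¬ x) _))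

  x∧¬x≤𝟘 : ∀ x → x ∧ ¬ x ≤ 𝟘
  x∧¬x≤𝟘 x = begin
    x ∧ ¬ x  ≤⟨ ∧-monotonic ≤-refl (x≤x∨y (¬ x) 𝟘) ⟩
    x · 𝟘    ≤⟨ residuation-from (𝟘-least (x \\ 𝟘)) ⟩
    𝟘        ∎

  x≤¬y∨y : ∀ x y → x ≤ ¬ y ∨ y
  x≤¬y∨y x y = begin
    x                ≤⟨ x≤¬y⇒y≤¬x (𝟘-least (¬ x)) ⟩
    ¬ 𝟘              ≤⟨ ¬-antitone (x∧¬x≤𝟘 y) ⟩
    ¬ (y ∧ ¬ y)      ≡⟨ deMorgan₁ y (¬ y) ⟩
    ¬ y ∨ ¬ (¬ y)    ≡⟨ cong (¬ y ∨_) (¬-involutive y) ⟩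
    ¬ y ∨ y          ∎

  ¬x≤∼x : ∀ x → ¬ x ≤ ∼ x
  ¬x≤∼x x = residuation-to (≤-trans (≤-reflexive (¬x≤y⇒x·y≡x∧y ≤-refl)) (x∧¬x≤𝟘 x))

  ¬∼x≤x : ∀ x → ¬ (∼ x) ≤ x
  ¬∼x≤x x = ¬x≤y⇒¬y≤x (¬x≤∼x x)

  x∧∼x≤𝟘 : ∀ x → x ∧ ∼ x ≤ 𝟘
  x∧∼x≤𝟘 x = begin
    x ∧ ∼ x  ≡⟨ ¬x≤y⇒x·y≡x∧y (¬x≤∼x x) ⟨
    x · ∼ x  ≤⟨ residuation-from ≤-refl ⟩
    𝟘        ∎

  ∼-antitone : ∀ {x y} → x ≤ y → ∼ y ≤ ∼ x
  ∼-antitone {x} {y} x≤y =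
    residuation-to (≤-trans (∧-greatest (x·y≤x x (∼ y)) x·∼y≤¬x) (x∧¬x≤𝟘 x))
    where
    x·∼y≤¬x : x · ∼ y ≤ ¬ x
    x·∼y≤¬x = begin
      x · ∼ y              ≤⟨ ∧-monotonic x≤y (y≤x∨y (¬ y) (¬ x ∨ ∼ y)) ⟩
      y · (¬ x ∨ ∼ y)      ≤⟨ ·-distribˡ-∨-≤ y (¬ x) (∼ y) ⟩
      y · ¬ x ∨ y · ∼ y    ≤⟨ ∨-monotonic (x∧y≤y y _)
                                           (≤-trans (residuation-from ≤-refl) (𝟘-least (¬ x))) ⟩
      (¬ y ∨ ¬ x) ∨ ¬ x    ≤⟨ ∨-least (∨-least (¬-antitone x≤y) ≤-refl) ≤-refl ⟩
      ¬ x                  ∎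

  x≤‾x : ∀ x → x ≤ ‾ x
  x≤‾x x = residuation-to (begin
    ∼ x · x  ≡⟨ ¬x≤y⇒x·y≡x∧y (¬∼x≤x x) ⟩
    ∼ x ∧ x  ≤⟨ ∧-greatest (x∧y≤y (∼ x) x) (x∧y≤x (∼ x) x) ⟩
    x ∧ ∼ x  ≤⟨ x∧∼x≤𝟘 x ⟩
    𝟘        ∎)

  ∼-galois : ∀ {x y} → y ≤ ∼ x → x ≤ ∼ y
  ∼-galois {x} y≤∼x = ≤-trans (x≤‾x x) (∼-antitone y≤∼x)

  ∼‾x≡∼x : ∀ x → ∼ (‾ x) ≡ ∼ x
  ∼‾x≡∼x x = ≤-antisym (∼-antitone (x≤‾x x)) (x≤‾x (∼ x))

  y≤∼x⇒y·x≤𝟘 : ∀ {x y} → y ≤ ∼ x → y · x ≤ 𝟘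
  y≤∼x⇒y·x≤𝟘 y≤∼x = residuation-from (∼-galois y≤∼x)

  ∼x∧∼¬x≤𝟘 : ∀ x → ∼ x ∧ ∼ (¬ x) ≤ 𝟘
  ∼x∧∼¬x≤𝟘 x = begin
    m                  ≤⟨ x≤y⇒x≤x·y (x≤¬y∨y m x) ⟩
    m · (¬ x ∨ x)      ≤⟨ ·-distribˡ-∨-≤ m (¬ x) x ⟩
    m · ¬ x ∨ m · x    ≤⟨ ∨-least (y≤∼x⇒y·x≤𝟘 (x∧y≤y (∼ x) _))
                                  (y≤∼x⇒y·x≤𝟘 (x∧y≤x _ (∼ (¬ x)))) ⟩
    𝟘                  ∎
    where
    m : Carrier
    m = ∼ x ∧ ∼ (¬ x)

  ‾¬x≡∼x : ∀ x → ‾ (¬ x) ≡ ∼ x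
  ‾¬x≡∼x x = ≤-antisym
    (≤-trans (∼-antitone (∼-antitone (¬x≤∼x x))) (≤-reflexive (∼‾x≡∼x x)))
    (∼-galois (residuation-to (begin
      ∼ x · ∼ (¬ x)  ≡⟨ ¬x≤y⇒x·y≡x∧y ¬∼x≤∼¬x ⟩
      ∼ x ∧ ∼ (¬ x)  ≤⟨ ∼x∧∼¬x≤𝟘 x ⟩
      𝟘              ∎)))
    where
    ¬∼x≤∼¬x : ¬ (∼ x) ≤ ∼ (¬ x)
    ¬∼x≤∼¬x = begin
      ¬ (∼ x)  ≤⟨ ¬∼x≤x x ⟩
      x        ≡⟨ ¬-involutive x ⟨
      ¬ (¬ x)  ≤⟨ ¬x≤∼x (¬ x) ⟩
      ∼ (¬ x)  ∎

  ‾x≡∼¬x : ∀ x → ‾ x ≡ ∼ (¬ x)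
  ‾x≡∼¬x x = trans (cong ‾ (sym (¬-involutive x))) (‾¬x≡∼x (¬ x))

  ∼-antidistrib-∨ : ∀ x y → ∼ (x ∨ y) ≡ ∼ x ∧ ∼ y
  ∼-antidistrib-∨ x y = ≤-antisym
    (∧-greatest (∼-antitone (x≤x∨y x y)) (∼-antitone (y≤x∨y x y)))
    (∼-galois (∨-least (∼-galois (x∧y≤x (∼ x) (∼ y))) (∼-galois (x∧y≤y (∼ x) (∼ y)))))

  x·y≤¬[x∧¬y] : ∀ x y → x · y ≤ ¬ (x ∧ ¬ y)
  x·y≤¬[x∧¬y] x y = begin
    x · y            ≤⟨ x∧y≤y x (¬ x ∨ y) ⟩
    ¬ x ∨ y          ≡⟨ cong (¬ x ∨_) (¬-involutive y) ⟨
    ¬ x ∨ ¬ (¬ y)    ≡⟨ deMorgan₁ x (¬ y) ⟨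
    ¬ (x ∧ ¬ y)      ∎

  v≤u⇒u·v≤‾v : ∀ {u v} → v ≤ u → u · v ≤ ‾ v
  v≤u⇒u·v≤‾v {u} {v} v≤u =
    ≤-trans (residuation-to ¬v·[u·v]≤𝟘) (≤-reflexive (sym (‾x≡∼¬x v)))
    where
    ¬¬v≤u·v : ¬ (¬ v) ≤ u · v
    ¬¬v≤u·v = ≤-trans (≤-reflexive (¬-involutive v)) (∧-greatest v≤u (y≤x∨y (¬ u) v))

    ¬v·[u·v]≤𝟘 : ¬ v · (u · v) ≤ 𝟘
    ¬v·[u·v]≤𝟘 = begin
      ¬ v · (u · v)                 ≡⟨ ¬x≤y⇒x·y≡x∧y ¬¬v≤u·v ⟩
      ¬ v ∧ u · v                   ≤⟨ ∧-greatest
                                         (∧-greatest (≤-trans (x∧y≤y (¬ v) _) (x·y≤x u v))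
                                                     (x∧y≤x (¬ v) _))
                                         (≤-trans (x∧y≤y (¬ v) _) (x·y≤¬[x∧¬y] u v)) ⟩
      (u ∧ ¬ v) ∧ ¬ (u ∧ ¬ v)       ≤⟨ x∧¬x≤𝟘 (u ∧ ¬ v) ⟩
      𝟘                             ∎

  ∼-antidistrib-∧ : ∀ x y → ∼ (x ∧ y) ≡ ∼ x ∨ ∼ y
  ∼-antidistrib-∧ x y = ≤-antisym ∼[x∧y]≤∼x∨∼y
    (∨-least (∼-antitone (x∧y≤x x y)) (∼-antitone (x∧y≤y x y)))
    where
    c d : Carrier
    c = x ∧ y
    d = ∼ c

    d·∼z≤∼z : ∀ {z} → c ≤ z → d · ∼ z ≤ ∼ z
    d·∼z≤∼z {z} c≤z = ≤-trans (v≤u⇒u·v≤‾v (∼-antitone c≤z)) (≤-reflexive (∼‾x≡∼x z))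

    ¬c≤∼x∨∼y : ¬ c ≤ ∼ x ∨ ∼ y
    ¬c≤∼x∨∼y = ≤-trans (≤-reflexive (deMorgan₁ x y)) (∨-monotonic (¬x≤∼x x) (¬x≤∼x y))

    ∼[x∧y]≤∼x∨∼y : d ≤ ∼ x ∨ ∼ y
    ∼[x∧y]≤∼x∨∼y = begin
      d                                ≤⟨ x≤y⇒x≤x·y (x≤¬y∨y d c) ⟩
      d · (¬ c ∨ c)                    ≤⟨ ·-monoʳ-≤ (∨-monotonic ¬c≤∼x∨∼y ≤-refl) ⟩
      d · ((∼ x ∨ ∼ y) ∨ c)            ≤⟨ ·-distribˡ-∨-≤ d (∼ x ∨ ∼ y) c ⟩
      d · (∼ x ∨ ∼ y) ∨ d · c          ≤⟨ ∨-monotonic (·-distribˡ-∨-≤ d (∼ x) (∼ y))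
                                                      (y≤∼x⇒y·x≤𝟘 ≤-refl) ⟩
      (d · ∼ x ∨ d · ∼ y) ∨ 𝟘          ≤⟨ ∨-least (∨-monotonic (d·∼z≤∼z (x∧y≤x x y))
                                                              (d·∼z≤∼z (x∧y≤y x y)))
                                                  (𝟘-least (∼ x ∨ ∼ y)) ⟩
      ∼ x ∨ ∼ y                        ∎

  ‾-idempotent : ∀ x → ‾ (‾ x) ≡ ‾ x
  ‾-idempotent x = ∼‾x≡∼x (∼ x)

  ‾¬x≡∼‾x : ∀ x → ‾ (¬ x) ≡ ∼ (‾ x)
  ‾¬x≡∼‾x x = trans (‾¬x≡∼x x) (sym (∼‾x≡∼x x))

  ‾-distrib-∨ : ∀ x y → ‾ (x ∨ y) ≡ ‾ x ∨ ‾ y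
  ‾-distrib-∨ x y = trans (cong ∼ (∼-antidistrib-∨ x y)) (∼-antidistrib-∧ (∼ x) (∼ y))

  ‾-distrib-∧ : ∀ x y → ‾ (x ∧ y) ≡ ‾ x ∧ ‾ y
  ‾-distrib-∧ x y = begin-equality
    ‾ (x ∧ y)              ≡⟨ ‾x≡∼¬x (x ∧ y) ⟩
    ∼ (¬ (x ∧ y))          ≡⟨ cong ∼ (deMorgan₁ x y) ⟩
    ∼ (¬ x ∨ ¬ y)          ≡⟨ ∼-antidistrib-∨ (¬ x) (¬ y) ⟩
    ∼ (¬ x) ∧ ∼ (¬ y)      ≡⟨ cong₂ _∧_ (‾x≡∼¬x x) (‾x≡∼¬x y) ⟨
    ‾ x ∧ ‾ y              ∎

  ‾[x·y]≡‾x*‾y : ∀ x y → ‾ (x · y) ≡ ‾ x * ‾ y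
  ‾[x·y]≡‾x*‾y x y = begin-equality
    ‾ (x ∧ (¬ x ∨ y))          ≡⟨ ‾-distrib-∧ x (¬ x ∨ y) ⟩
    ‾ x ∧ ‾ (¬ x ∨ y)          ≡⟨ cong (‾ x ∧_) (‾-distrib-∨ (¬ x) y) ⟩
    ‾ x ∧ (‾ (¬ x) ∨ ‾ y)      ≡⟨ cong (λ z → ‾ x ∧ (z ∨ ‾ y)) (‾¬x≡∼‾x x) ⟩
    ‾ x ∧ (∼ (‾ x) ∨ ‾ y)      ∎

lemma4p4 : {a : Level} (A : ResiduatedOrtholattice a) →
    let open ResiduatedOrtholattice A in
    ∀ x y →
      ((‾ (‾ x) ≡ ‾ x) × (‾ (¬ x) ≡ ∼ (‾ x)) × (∼ (‾ x) ≡ ∼ x))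
      × ((‾ (x ∨ y) ≡ ‾ x ∨ ‾ y) × (‾ (x ∧ y) ≡ ‾ x ∧ ‾ y))
      × (‾ (x · y) ≡ ‾ x * ‾ y)
lemma4p4 A x y =
    (‾-idempotent x , ‾¬x≡∼‾x x , ∼‾x≡∼x x)
  , (‾-distrib-∨ x y , ‾-distrib-∧ x y)
  , ‾[x·y]≡‾x*‾y x y
  where open ResiduatedOrtholatticeProperties A
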